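{- Let $\alpha$ be a dotted composition of length $\ell$, let $A\subset\mathbb{N}$ be finite with $|A|=\ell$, and let $\sigma\in\mathfrak{S}_\infty$. Then under the quasisymmetrizing action in superspace, $\sigma\cdot A^\alpha=\sigma(A)^\alpha$, where $\sigma(A)=\{\sigma(a):a\in A\}$.
   Context: $\mathbb{Q}^\theta[[x]]$ is the algebra of bounded-degree formal power series in $x_1,x_2,\ldots$ and $\theta_1,\theta_2,\ldots$ with $x_ix_j=x_jx_i$, $x_i\theta_j=\theta_jx_i$, $\theta_i\theta_j=-\theta_j\theta_i$; monomials are written in normal form $\theta_{i_1}\cdots\theta_{i_m}x_{j_1}\cdots x_{j_n}$ with $i_1<\cdots<i_m$, $j_1\le\cdots\le j_n$. A dotted composition is a finite sequence $(\alpha_1,\ldots,\alpha_\ell)$ with each $\alpha_i$ a positive integer $a$ (set $\underline\alpha_i=a,\bar\alpha_i=0$) or a dotted nonnegative integer $\dot a$ (set $\underline\alpha_i=a,\bar\alpha_i=1$). For $A=\{a_1<\cdots<a_\ell\}$, $A^\alpha$ is the monic monomial $\theta_{a_1}^{\bar\alpha_1}\cdots\theta_{a_\ell}^{\bar\alpha_\ell}x_{a_1}^{\underline\alpha_1}\cdots x_{a_\ell}^{\underline\alpha_\ell}$. Quasisymmetrizing action: encode a monic monomial $\prod\theta_i^{\epsilon_i}\prod x_i^{a_i}$ by the infinite sequence $(\alpha_1,\alpha_2,\ldots)$ with $\alpha_i=a_i$ (undotted) if $\epsilon_i=0$ and $\alpha_i=\dot a_i$ if $\epsilon_i=1$ (a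 bijection onto sequences with finitely many entries different from undotted $0$). The simple transposition $s_i=(i\ i+1)$ exchanges $\alpha_i$ and $\alpha_{i+1}$ if at least one of them is the undotted $0$, and acts trivially otherwise; this defines an action of the finitary symmetric group $\mathfrak{S}_\infty$ on monic monomials. -}

module Defs where

open import Data.Nat using (ℕ; zero; suc; _<_; _≡ᵇ_)
open import Data.Bool using (Bool; true; false; if_then_else_; _∨_)
open import Data.Product using (_×_; _,_)
open import Data.List using (List; []; _∷_)
open import Data.Vec using (Vec; []; _∷_; lookup)
open import Data.Fin as Fin using (Fin)

-- A "dotted integer": (a , false) is the undotted integer a,
-- (a , true) is the dotted integer ȧ.
DInt : Set
DInt = ℕ × Bool

undotted0 : DInt
undotted0 = (0 , false)

isUndotted0 : DInt → Bool
isUndotted0 (zero , false) = true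
isUndotted0 _              = false

IsDottedComposition : {ℓ : ℕ} → Vec DInt ℓ → Set
IsDottedComposition {ℓ} α = (i : Fin ℓ) → IsPart (lookup α i)
  where
  IsPart : DInt → Set
  IsPart (a , false) = 0 < a
  IsPart (a , true)  = Data.Unit.⊤ where import Data.Unit

-- A monic monomial of Q^θ[[x]], encoded as its sequence of dotted exponents.
-- Position p : ℕ corresponds to the variables θ_{p+1}, x_{p+1} (0-based indexing).
Mono : Set
Mono = ℕ → DInt

swapℕ : ℕ → ℕ → ℕ
swapℕ i p = if p ≡ᵇ i then suc i else (if p ≡ᵇ suc i then i else p)

sAct : ℕ → Mono → Mono
sAct i m = if isUndotted0 (m i) ∨ isUndotted0 (m (suc i))
           then (λ p → m (swapℕ i p))
           else m

-- An element σ of the finitary symmetric group, given as a word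
-- w = (i₁, …, i_k) meaning σ = s_{i₁} s_{i₂} ⋯ s_{i_k}.
-- Its action on monomials:
act : List ℕ → Mono → Mono
act []      m = m
act (i ∷ w) m = sAct i (act w m)

permℕ : List ℕ → ℕ → ℕ
permℕ []      p = p
permℕ (i ∷ w) p = swapℕ i (permℕ w p)

-- A finite set A = {a₁ < ⋯ < a_ℓ} ⊂ ℕ, given by its increasing enumeration
StrictlyIncreasing : {ℓ : ℕ} → Vec ℕ ℓ → Set
StrictlyIncreasing {ℓ} A = (j k : Fin ℓ) → j Fin.< k → lookup A j < lookup A k

-- A^α = θ_{a₁}^{ᾱ₁}⋯ x_{a₁}^{α₁}⋯ : entry α_k at position a_k, undotted 0 elsewhere
monomial : {ℓ : ℕ} → Vec ℕ ℓ → Vec DInt ℓ → Mono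
monomial []      []      p = undotted0
monomial (a ∷ A) (x ∷ α) p = if p ≡ᵇ a then x else monomial A α p

-- Induct on the word w = i ∷ w′, so σ = s_i σ′, and let B enumerate σ(A) increasingly.
-- If i and i+1 both lie in B, then B is s_i-stable, hence also enumerates σ′(A), and s_i
-- fixes B^α because both of its entries at i, i+1 are nonzero.  Otherwise s_i B is still
-- increasing and enumerates σ′(A); as i or i+1 is missing from s_i B, the monomial
-- (s_i B)^α has an undotted 0 there, so s_i exchanges the two entries and yields B^α.
module Submission where

open import Defs
open import Data.Nat using (ℕ)
open import Data.Product using (_×_)
open import Data.List using (List)
open import Data.Vec using (Vec; map)
open import Data.Vec.Membership.Propositional using (_∈_)
open import Relation.Binary.PropositionalEquality using (_≡_)

open import Data.Bool using (true; false; _∨_; if_then_else_)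
open import Data.Bool.Properties using (∨-zeroʳ)
import Data.Fin as Fin
open import Data.List using ([]; _∷_)
open import Data.Nat using (zero; suc; _<_; _≡ᵇ_; s≤s; z≤n)
open import Data.Nat.Properties
  using (_≟_; 1+n≢n; <-irrefl; <-asym; <-trans; ≤∧≢⇒<; n<1+n; m<1+n⇒m≤n)
open import Data.Product using (∃; _,_; proj₁; proj₂)
open import Data.Sum using (_⊎_; inj₁; inj₂; [_,_]′)
open import Data.Vec using ([]; _∷_; lookup)
open import Data.Vec.Membership.Propositional using (_∉_; find)
open import Data.Vec.Membership.Propositional.Properties using (∈-lookup; ∈-map⁺)
open import Data.Vec.Membership.DecPropositional _≟_ using (_∈?_)
open import Data.Vec.Properties using (map-id; lookup-map)
open import Data.Vec.Relation.Unary.Any as Any using (here; there)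
open import Data.Vec.Relation.Unary.Any.Properties using (map⁻; lookup-index)
open import Function using (_∘_)
open import Relation.Binary.PropositionalEquality
  using (_≢_; _≗_; refl; sym; trans; cong; cong₂; subst; module ≡-Reasoning)
open import Relation.Nullary using (¬_; Dec; yes; no; contradiction)
open import Relation.Nullary.Decidable using (dec-true; dec-false)
open import Relation.Unary using (_≐_)
open import Relation.Unary.Properties using (≐-sym; ≐-trans)

≡ᵇ-true : ∀ {m n} → m ≡ n → (m ≡ᵇ n) ≡ true
≡ᵇ-true {m} {n} = dec-true (m ≟ n)

≡ᵇ-false : ∀ {m n} → m ≢ n → (m ≡ᵇ n) ≡ false
≡ᵇ-false {m} {n} = dec-false (m ≟ n)

≡ᵇ-cong : ∀ {m n m′ n′} → (m ≡ n → m′ ≡ n′) → (m′ ≡ n′ → m ≡ n) → (m ≡ᵇ n) ≡ (m′ ≡ᵇ n′)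
≡ᵇ-cong {m} {n} to from with m ≟ n
... | yes m≡n = trans (≡ᵇ-true m≡n) (sym (≡ᵇ-true (to m≡n)))
... | no m≢n  = trans (≡ᵇ-false m≢n) (sym (≡ᵇ-false (m≢n ∘ from)))

module _ (i : ℕ) where

  data SwapView : ℕ → Set where
    left  : SwapView i
    right : SwapView (suc i)
    other : ∀ {p} → p ≢ i → p ≢ suc i → SwapView p

  swapView : ∀ p → SwapView p
  swapView p with p ≟ i | p ≟ suc i
  ... | yes refl | _        = left
  ... | no _     | yes refl = right
  ... | no p≢i   | no p≢1+i = other p≢i p≢1+i

  swapℕ-left : swapℕ i i ≡ suc i
  swapℕ-left rewrite ≡ᵇ-true {i} refl = refl

  swapℕ-right : swapℕ i (suc i) ≡ i
  swapℕ-right rewrite ≡ᵇ-false (1+n≢n {i}) | ≡ᵇ-true {suc i} refl = refl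

  swapℕ-other : ∀ {p} → p ≢ i → p ≢ suc i → swapℕ i p ≡ p
  swapℕ-other p≢i p≢1+i rewrite ≡ᵇ-false p≢i | ≡ᵇ-false p≢1+i = refl

  swapℕ-involutive : ∀ p → swapℕ i (swapℕ i p) ≡ p
  swapℕ-involutive p with swapView p
  ... | left  rewrite swapℕ-left  = swapℕ-right
  ... | right rewrite swapℕ-right = swapℕ-left
  ... | other p≢i p≢1+i rewrite swapℕ-other p≢i p≢1+i = swapℕ-other p≢i p≢1+i

  swapℕ-injective : ∀ {p q} → swapℕ i p ≡ swapℕ i q → p ≡ q
  swapℕ-injective {p} {q} e =
    trans (sym (swapℕ-involutive p)) (trans (cong (swapℕ i) e) (swapℕ-involutive q))

  swapℕ-<-mono : ∀ {b b′} → b < b′ → ¬ (b ≡ i × b′ ≡ suc i) → swapℕ i b < swapℕ i b′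
  swapℕ-<-mono {b} {b′} b<b′ not-adjacent with swapView b | swapView b′
  ... | left  | left  = contradiction b<b′ (<-irrefl refl)
  ... | left  | right = contradiction (refl , refl) not-adjacent
  ... | left  | other b′≢i b′≢1+i
    rewrite swapℕ-left | swapℕ-other b′≢i b′≢1+i = ≤∧≢⇒< b<b′ (b′≢1+i ∘ sym)
  ... | right | left  = contradiction (n<1+n i) (<-asym b<b′)
  ... | right | right = contradiction b<b′ (<-irrefl refl)
  ... | right | other b′≢i b′≢1+i
    rewrite swapℕ-right | swapℕ-other b′≢i b′≢1+i = <-trans (n<1+n i) b<b′
  ... | other b≢i b≢1+i | left
    rewrite swapℕ-other b≢i b≢1+i | swapℕ-left = <-trans b<b′ (n<1+n i)
  ... | other b≢i b≢1+i | right
    rewrite swapℕ-other b≢i b≢1+i | swapℕ-right = ≤∧≢⇒< (m<1+n⇒m≤n b<b′) b≢i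
  ... | other b≢i b≢1+i | other b′≢i b′≢1+i
    rewrite swapℕ-other b≢i b≢1+i | swapℕ-other b′≢i b′≢1+i = b<b′

∈-map⁻ : ∀ {n} {f : ℕ → ℕ} {x} {V : Vec ℕ n} → x ∈ map f V → ∃ λ y → y ∈ V × x ≡ f y
∈-map⁻ = find ∘ map⁻

∈-map-involutive : ∀ {n} {f : ℕ → ℕ} {V : Vec ℕ n} → (∀ x → f (f x) ≡ x) →
                   (_∈ map f V) ≐ ((_∈ V) ∘ f)
∈-map-involutive {f = f} {V} f-invol = to , from
  where
  to : ∀ {x} → x ∈ map f V → f x ∈ V
  to x∈fV with ∈-map⁻ x∈fV
  ... | y , y∈V , refl = subst (_∈ V) (sym (f-invol y)) y∈V
  from : ∀ {x} → f x ∈ V → x ∈ map f V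
  from {x} fx∈V = subst (_∈ map f V) (f-invol x) (∈-map⁺ f fx∈V)

∈-map-∘-injective : ∀ {n} {f g : ℕ → ℕ} {V : Vec ℕ n} → (∀ {x y} → g x ≡ g y → x ≡ y) →
                    ((_∈ map (g ∘ f) V) ∘ g) ≐ (_∈ map f V)
∈-map-∘-injective {f = f} {g} {V} g-inj = to , from
  where
  to : ∀ {x} → g x ∈ map (g ∘ f) V → x ∈ map f V
  to gx∈gfV with ∈-map⁻ gx∈gfV
  ... | y , y∈V , gx≡gfy = subst (_∈ map f V) (sym (g-inj gx≡gfy)) (∈-map⁺ f y∈V)
  from : ∀ {x} → x ∈ map f V → g x ∈ map (g ∘ f) V
  from x∈fV with ∈-map⁻ x∈fV
  ... | y , y∈V , refl = ∈-map⁺ (g ∘ f) y∈V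

StrictlyIncreasing-tail : ∀ {n a} {A : Vec ℕ n} → StrictlyIncreasing (a ∷ A) → StrictlyIncreasing A
StrictlyIncreasing-tail A↑ j k j<k = A↑ (Fin.suc j) (Fin.suc k) (s≤s j<k)

StrictlyIncreasing-head< : ∀ {n a x} {A : Vec ℕ n} → StrictlyIncreasing (a ∷ A) → x ∈ A → a < x
StrictlyIncreasing-head< A↑ x∈A
  rewrite lookup-index x∈A = A↑ Fin.zero (Fin.suc (Any.index x∈A)) (s≤s z≤n)

StrictlyIncreasing-unique : ∀ {n} {A B : Vec ℕ n} → StrictlyIncreasing A → StrictlyIncreasing B →
                            (_∈ A) ≐ (_∈ B) → A ≡ B
StrictlyIncreasing-unique {A = []} {[]} _ _ _ = refl
StrictlyIncreasing-unique {A = a ∷ A} {b ∷ B} A↑ B↑ (A⊆B , B⊆A)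
  = cong₂ _∷_ a≡b (StrictlyIncreasing-unique (StrictlyIncreasing-tail A↑)
                                             (StrictlyIncreasing-tail B↑) (A⊆B′ , B⊆A′))
  where
  a≡b : a ≡ b
  a≡b with A⊆B (here refl) | B⊆A (here refl)
  ... | here a≡b | _        = a≡b
  ... | there _  | here b≡a = sym b≡a
  ... | there a∈B | there b∈A =
    contradiction (StrictlyIncreasing-head< B↑ a∈B) (<-asym (StrictlyIncreasing-head< A↑ b∈A))
  A⊆B′ : ∀ {x} → x ∈ A → x ∈ B
  A⊆B′ x∈A with A⊆B (there x∈A)
  ... | here refl = contradiction (StrictlyIncreasing-head< A↑ x∈A) (<-irrefl a≡b)
  ... | there x∈B = x∈B
  B⊆A′ : ∀ {x} → x ∈ B → x ∈ A
  B⊆A′ x∈B with B⊆A (there x∈B)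
  ... | here refl = contradiction (StrictlyIncreasing-head< B↑ x∈B) (<-irrefl (sym a≡b))
  ... | there x∈A = x∈A

map-swapℕ-increasing : ∀ {n} i {B : Vec ℕ n} → StrictlyIncreasing B → ¬ (i ∈ B × suc i ∈ B) →
                       StrictlyIncreasing (map (swapℕ i) B)
map-swapℕ-increasing i {B} B↑ not-both j k j<k
  rewrite lookup-map j (swapℕ i) B | lookup-map k (swapℕ i) B =
  swapℕ-<-mono i (B↑ j k j<k) λ (bj≡i , bk≡1+i) →
    not-both (subst (_∈ B) bj≡i (∈-lookup j B) , subst (_∈ B) bk≡1+i (∈-lookup k B))

monomial-∉ : ∀ {n} (B : Vec ℕ n) (α : Vec DInt n) {p} → p ∉ B → monomial B α p ≡ undotted0
monomial-∉ []      []      p∉B = refl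
monomial-∉ (a ∷ B) (x ∷ α) p∉B
  rewrite ≡ᵇ-false (p∉B ∘ here) = monomial-∉ B α (p∉B ∘ there)

monomial-∈ : ∀ {n} (B : Vec ℕ n) (α : Vec DInt n) {p} → p ∈ B → monomial B α p ∈ α
monomial-∈ (a ∷ B) (x ∷ α) {p} p∈aB with p ≟ a | p∈aB
... | yes p≡a | _         rewrite ≡ᵇ-true p≡a  = here refl
... | no p≢a  | here p≡a  = contradiction p≡a p≢a
... | no p≢a  | there p∈B rewrite ≡ᵇ-false p≢a = there (monomial-∈ B α p∈B)

monomial-map : ∀ {n} {f g : ℕ → ℕ} → (∀ x → g (f x) ≡ x) → (∀ x → f (g x) ≡ x) →
               (B : Vec ℕ n) (α : Vec DInt n) → monomial (map f B) α ≗ monomial B α ∘ g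
monomial-map gf fg []      []      p = refl
monomial-map {f = f} {g} gf fg (a ∷ B) (x ∷ α) p
  = cong₂ (λ b rest → if b then x else rest)
          (≡ᵇ-cong (λ p≡fa → trans (cong g p≡fa) (gf a)) (λ gp≡a → trans (sym (fg p)) (cong f gp≡a)))
          (monomial-map gf fg B α p)

isUndotted0-∈-composition : ∀ {n} {α : Vec DInt n} {x} → IsDottedComposition α → x ∈ α →
                            isUndotted0 x ≡ false
isUndotted0-∈-composition {α = α} α-comp x∈α
  with lookup α (Any.index x∈α) | α-comp (Any.index x∈α) | lookup-index x∈α
... | zero  , false | () | _
... | suc _ , false | _  | refl = refl
... | zero  , true  | _  | refl = refl
... | suc _ , true  | _  | refl = refl

-- Without function extensionality the induction hypothesis only yields pointwise equality.
sAct-cong : ∀ i {m m′ : Mono} → m ≗ m′ → sAct i m ≗ sAct i m′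
sAct-cong i {m} {m′} m≗m′ p rewrite m≗m′ i | m≗m′ (suc i)
  with isUndotted0 (m′ i) ∨ isUndotted0 (m′ (suc i))
... | true  = m≗m′ (swapℕ i p)
... | false = m≗m′ p

sAct-fixes : ∀ i {m : Mono} → isUndotted0 (m i) ≡ false → isUndotted0 (m (suc i)) ≡ false →
             sAct i m ≗ m
sAct-fixes i mi≢0 m1+i≢0 p rewrite mi≢0 | m1+i≢0 = refl

sAct-swaps : ∀ i {m : Mono} → m i ≡ undotted0 ⊎ m (suc i) ≡ undotted0 → sAct i m ≗ m ∘ swapℕ i
sAct-swaps i (inj₁ mi≡0) p rewrite mi≡0 = refl
sAct-swaps i {m} (inj₂ m1+i≡0) p rewrite m1+i≡0 | ∨-zeroʳ (isUndotted0 (m i)) = refl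

module _ {ℓ} {α : Vec DInt ℓ} (α-comp : IsDottedComposition α) where
  open ≡-Reasoning

  act-monomial : ∀ w {A B : Vec ℕ ℓ} → StrictlyIncreasing A → StrictlyIncreasing B →
                 (_∈ B) ≐ (_∈ map (permℕ w) A) → act w (monomial A α) ≗ monomial B α
  act-monomial [] {A} {B} A↑ B↑ B≐A p = cong (λ V → monomial V α p) A≡B
    where
    A≡B : A ≡ B
    A≡B = StrictlyIncreasing-unique A↑ B↑ (≐-sym (subst (λ V → _ ≐ (_∈ V)) (map-id A) B≐A))
  act-monomial (i ∷ w) {A} {B} A↑ B↑ B≐σA = by-cases (i ∈? B) (suc i ∈? B)
    where
    descend : ∀ {C : Vec ℕ ℓ} → (_∈ C) ≐ ((_∈ B) ∘ swapℕ i) → (_∈ C) ≐ (_∈ map (permℕ w) A)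
    descend C≐sB =
      ≐-trans C≐sB (≐-trans (proj₁ B≐σA , proj₂ B≐σA) (∈-map-∘-injective (swapℕ-injective i)))

    stable : i ∈ B → suc i ∈ B → sAct i (act w (monomial A α)) ≗ monomial B α
    stable i∈B 1+i∈B p = begin
      sAct i (act w (monomial A α)) p ≡⟨ sAct-cong i (act-monomial w A↑ B↑ (descend B≐sB)) p ⟩
      sAct i (monomial B α) p         ≡⟨ sAct-fixes i (nonzero i∈B) (nonzero 1+i∈B) p ⟩
      monomial B α p                  ∎
      where
      nonzero : ∀ {q} → q ∈ B → isUndotted0 (monomial B α q) ≡ false
      nonzero q∈B = isUndotted0-∈-composition α-comp (monomial-∈ B α q∈B)
      swap-∈ : ∀ {q} → q ∈ B → swapℕ i q ∈ B
      swap-∈ {q} q∈B with swapView i q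
      ... | left  rewrite swapℕ-left i  = 1+i∈B
      ... | right rewrite swapℕ-right i = i∈B
      ... | other q≢i q≢1+i rewrite swapℕ-other i q≢i q≢1+i = q∈B
      B≐sB : (_∈ B) ≐ ((_∈ B) ∘ swapℕ i)
      B≐sB = swap-∈ , λ {q} sq∈B → subst (_∈ B) (swapℕ-involutive i q) (swap-∈ sq∈B)

    swapped : i ∉ B ⊎ suc i ∉ B → sAct i (act w (monomial A α)) ≗ monomial B α
    swapped gap p = begin
      sAct i (act w (monomial A α)) p
        ≡⟨ sAct-cong i (act-monomial w A↑ C↑ (descend C≐sB)) p ⟩
      sAct i (monomial C α) p
        ≡⟨ sAct-swaps i {monomial C α} C-gap p ⟩
      monomial C α (swapℕ i p)
        ≡⟨ monomial-map {f = swapℕ i} {g = swapℕ i} s-invol s-invol B α (swapℕ i p) ⟩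
      monomial B α (swapℕ i (swapℕ i p))
        ≡⟨ cong (monomial B α) (s-invol p) ⟩
      monomial B α p
        ∎
      where
      s-invol : ∀ q → swapℕ i (swapℕ i q) ≡ q
      s-invol = swapℕ-involutive i
      C : Vec ℕ ℓ
      C = map (swapℕ i) B
      C≐sB : (_∈ C) ≐ ((_∈ B) ∘ swapℕ i)
      C≐sB = ∈-map-involutive s-invol
      C↑ : StrictlyIncreasing C
      C↑ = map-swapℕ-increasing i B↑ λ where
        (i∈B , 1+i∈B) → [ (λ i∉B → i∉B i∈B) , (λ 1+i∉B → 1+i∉B 1+i∈B) ]′ gap
      ∉C : ∀ {q r} → swapℕ i q ≡ r → r ∉ B → q ∉ C
      ∉C sq≡r r∉B q∈C = r∉B (subst (_∈ B) sq≡r (proj₁ C≐sB q∈C))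
      C-gap : monomial C α i ≡ undotted0 ⊎ monomial C α (suc i) ≡ undotted0
      C-gap = [ (λ i∉B → inj₂ (monomial-∉ C α (∉C (swapℕ-right i) i∉B)))
              , (λ 1+i∉B → inj₁ (monomial-∉ C α (∉C (swapℕ-left i) 1+i∉B))) ]′ gap

    by-cases : Dec (i ∈ B) → Dec (suc i ∈ B) → sAct i (act w (monomial A α)) ≗ monomial B α
    by-cases (yes i∈B) (yes 1+i∈B) = stable i∈B 1+i∈B
    by-cases (no i∉B)  _           = swapped (inj₁ i∉B)
    by-cases (yes _)   (no 1+i∉B)  = swapped (inj₂ 1+i∉B)

proposition3p1 : (ℓ : ℕ) (α : Vec DInt ℓ) → IsDottedComposition α →
    (A : Vec ℕ ℓ) → StrictlyIncreasing A →
    (w : List ℕ) →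
    (B : Vec ℕ ℓ) → StrictlyIncreasing B →
    ((x : ℕ) → (x ∈ B → x ∈ map (permℕ w) A) × (x ∈ map (permℕ w) A → x ∈ B)) →
    (p : ℕ) → act w (monomial A α) p ≡ monomial B α p
proposition3p1 ℓ α α-comp A A↑ w B B↑ B≐σA =
  act-monomial α-comp w A↑ B↑ ((λ {x} → proj₁ (B≐σA x)) , (λ {x} → proj₂ (B≐σA x)))
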